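{- For finite sets of formulas $\Gamma,\Delta$: the sequent $\Gamma\Rightarrow\Delta$ is derivable in QGPM if and only if the sequent $\Gamma\Rightarrow\bigvee\Delta$ is derivable in QGP+(CD).
   Context: Language: first-order, predicate symbols and constants, no function symbols; connectives $\top,\wedge,\vee,\rightarrow,\forall,\exists$; disjoint sets of free variables $a,b,\dots$ (only free) and bound variables $x,y,\dots$ (only bound). $\phi[u/x]$ is substitution; $\phi(a)$ is $\phi(x)$ with $a$ for $x$. $\bigvee\Delta$ is the disjunction of the formulas of $\Delta$. QGPM: sequents $\Gamma\Rightarrow\Delta$ ($\Gamma,\Delta$ finite sets); axioms $\phi\Rightarrow\phi$, $\Rightarrow\top$; rules ($\wedge$L) $\Gamma,\phi,\psi\Rightarrow\Delta$ / $\Gamma,\phi\wedge\psi\Rightarrow\Delta$; ($\wedge$R) $\Gamma\Rightarrow\Delta,\phi$ and $\Gamma\Rightarrow\Delta,\psi$ / $\Gamma\Rightarrow\Delta,\phi\wedge\psi$; ($\vee$L) $\Gamma,\phi\Rightarrow\Delta$ and $\Gamma,\psi\Rightarrow\Delta$ / $\Gamma,\phi\vee\psi\Rightarrow\Delta$; ($\vee$R) $\Gamma\Rightarrow\Delta,\phi,\psi$ / $\Gamma\Rightarrow\Delta,\phi\vee\psi$; ($\rightarrow$L) $\Gamma,\psi\Rightarrow\Delta$ and $\Gamma\Rightarrow\Delta,\phi$ / $\Gamma,\phi\rightarrow\psi\Rightarrow\Delta$; ($\rightarrow$Rp) $\Gamma\Rightarrow\psi,\Delta$ / $\Gamma\Rightarrow\phi\rightarrow\psi,\Delta$;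 ($\forall$R) $\Gamma\Rightarrow\Delta,\phi(a)$ / $\Gamma\Rightarrow\Delta,\forall x\phi(x)$ with $a$ not occurring in the conclusion; ($\forall$L) $\Gamma,\phi[u/x]\Rightarrow\Delta$ / $\Gamma,\forall x\phi(x)\Rightarrow\Delta$, $u$ a constant or free variable; ($\exists$R) $\Gamma\Rightarrow\Delta,\phi[u/x]$ / $\Gamma\Rightarrow\Delta,\exists x\phi(x)$; ($\exists$L) $\Gamma,\phi(a)\Rightarrow\Delta$ / $\Gamma,\exists x\phi(x)\Rightarrow\Delta$ with $a$ not in the conclusion; (Weakening) $\Gamma\Rightarrow\Delta$ / $\Gamma,\Gamma_1\Rightarrow\Delta,\Delta_1$; (Cut) $\Gamma\Rightarrow\Delta,\phi$ and $\phi,\Gamma_1\Rightarrow\Delta_1$ / $\Gamma,\Gamma_1\Rightarrow\Delta,\Delta_1$. QGP: single-conclusion version with sequents $\Gamma\Rightarrow\theta$ (exactly one formula on the right); axioms $\phi\Rightarrow\phi$, $\Rightarrow\top$; rules ($\wedge$L) $\Gamma,\phi,\psi\Rightarrow\theta$ / $\Gamma,\phi\wedge\psi\Rightarrow\theta$; ($\wedge$R) $\Gamma\Rightarrow\phi$, $\Gamma\Rightarrow\psi$ / $\Gamma\Rightarrow\phi\wedge\psi$; ($\vee$L) $\Gamma,\phi\Rightarrow\theta$ and $\Gamma,\psi\Rightarrow\theta$ / $\Gamma,\phi\vee\psi\Rightarrow\theta$; ($\vee$R) $\Gamma\Rightarrow\phi_i$ / $\Gamma\Rightarrow\phi_1\vee\phi_2$;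 ($\rightarrow$L) $\Gamma,\psi\Rightarrow\theta$ and $\Gamma\Rightarrow\phi$ / $\Gamma,\phi\rightarrow\psi\Rightarrow\theta$; ($\rightarrow$Rp) $\Gamma\Rightarrow\psi$ / $\Gamma\Rightarrow\phi\rightarrow\psi$; ($\forall$R) $\Gamma\Rightarrow\phi(a)$ / $\Gamma\Rightarrow\forall x\phi(x)$ ($a$ not in conclusion); ($\forall$L) $\Gamma,\phi[u/x]\Rightarrow\theta$ / $\Gamma,\forall x\phi(x)\Rightarrow\theta$; ($\exists$R) $\Gamma\Rightarrow\phi[u/x]$ / $\Gamma\Rightarrow\exists x\phi(x)$; ($\exists$L) $\Gamma,\phi(a)\Rightarrow\theta$ / $\Gamma,\exists x\phi(x)\Rightarrow\theta$ ($a$ not in conclusion); (Weakening) $\Gamma\Rightarrow\theta$ / $\Gamma,\Gamma_1\Rightarrow\theta$; (Cut) $\Gamma\Rightarrow\phi$ and $\phi,\Gamma_1\Rightarrow\theta$ / $\Gamma,\Gamma_1\Rightarrow\theta$. QGP+(CD) is QGP with all sequents $\forall x(A\vee B(x))\Rightarrow A\vee\forall x B(x)$ (constant domain principle, for arbitrary formulas $A$, $B(x)$) added as axioms. -}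

module Defs where

open import Data.Nat using (ℕ; zero; suc)
open import Data.Fin using (Fin; zero; suc)
open import Data.List using (List; []; _∷_; _++_)
open import Data.List.NonEmpty using (List⁺; _∷_; toList)
open import Data.List.Membership.Propositional using (_∈_; _∉_)
open import Data.List.Relation.Binary.Subset.Propositional using (_⊆_)
open import Data.List.Relation.Unary.All using (All)
open import Data.Product using (_×_)

-- Predicate symbols, constants and free variables are named by
-- natural numbers (infinitely many free variables are available).
-- Bound variables are represented by de Bruijn indices: a `Term n` /
-- `Formula n` lives in a scope of n bound variables; closed formulas
-- (the formulas of the language, in which bound variables occur only
-- bound) are `Formula 0`.

data Term (n : ℕ) : Set where
  bvar  : Fin n → Term n
  fvar  : ℕ → Term n
  const : ℕ → Term n

data Formula (n : ℕ) : Set where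
  atom : ℕ → List (Term n) → Formula n
  ⊤'   : Formula n
  _∧'_ : Formula n → Formula n → Formula n
  _∨'_ : Formula n → Formula n → Formula n
  _⇒'_ : Formula n → Formula n → Formula n
  ∀'   : Formula (suc n) → Formula n
  ∃'   : Formula (suc n) → Formula n

infixr 6 _∧'_
infixr 5 _∨'_
infixr 4 _⇒'_

Fm : Set
Fm = Formula 0

data CTerm : Set where
  cfvar  : ℕ → CTerm
  cconst : ℕ → CTerm

wkT : ∀ {n} → Term n → Term (suc n)
wkT (bvar i)  = bvar (suc i)
wkT (fvar a)  = fvar a
wkT (const c) = const c

substT : ∀ {n m} → (Fin n → Term m) → Term n → Term m
substT σ (bvar i)  = σ i
substT σ (fvar a)  = fvar a
substT σ (const c) = const c

lift : ∀ {n m} → (Fin n → Term m) → Fin (suc n) → Term (suc m)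
lift σ zero    = bvar zero
lift σ (suc i) = wkT (σ i)

substTs : ∀ {n m} → (Fin n → Term m) → List (Term n) → List (Term m)
substTs σ []       = []
substTs σ (t ∷ ts) = substT σ t ∷ substTs σ ts

substF : ∀ {n m} → (Fin n → Term m) → Formula n → Formula m
substF σ (atom P ts) = atom P (substTs σ ts)
substF σ ⊤'          = ⊤'
substF σ (φ ∧' ψ)    = substF σ φ ∧' substF σ ψ
substF σ (φ ∨' ψ)    = substF σ φ ∨' substF σ ψ
substF σ (φ ⇒' ψ)    = substF σ φ ⇒' substF σ ψ
substF σ (∀' φ)      = ∀' (substF (lift σ) φ)
substF σ (∃' φ)      = ∃' (substF (lift σ) φ)

cterm : ∀ {n} → CTerm → Term n
cterm (cfvar a)  = fvar a
cterm (cconst c) = const c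

-- φ[u/x] : instantiate the bound variable x of the body φ(x) of a
-- quantifier ∀xφ(x) / ∃xφ(x) by the constant or free variable u.
_[_] : Formula 1 → CTerm → Fm
φ [ u ] = substF (λ _ → cterm u) φ

-- weakening of a closed formula into the scope of one bound variable
-- (a formula A in which x does not occur)
wkF : Fm → Formula 1
wkF = substF (λ ())

fvT : ∀ {n} → Term n → List ℕ
fvT (bvar i)  = []
fvT (fvar a)  = a ∷ []
fvT (const c) = []

fvTs : ∀ {n} → List (Term n) → List ℕ
fvTs []       = []
fvTs (t ∷ ts) = fvT t ++ fvTs ts

fv : ∀ {n} → Formula n → List ℕ
fv (atom P ts) = fvTs ts
fv ⊤'          = []
fv (φ ∧' ψ)    = fv φ ++ fv ψ
fv (φ ∨' ψ)    = fv φ ++ fv ψ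
fv (φ ⇒' ψ)    = fv φ ++ fv ψ
fv (∀' φ)      = fv φ
fv (∃' φ)      = fv φ

FreshIn : ℕ → List Fm → Set
FreshIn a Γ = All (λ φ → a ∉ fv φ) Γ

-- Finite sets of formulas are represented by lists, identified up to
-- having the same elements (structural rule `set`).

_≈ₛ_ : List Fm → List Fm → Set
Γ ≈ₛ Γ' = (Γ ⊆ Γ') × (Γ' ⊆ Γ)

-- QGPM (multi-conclusion).  "Γ, φ" is φ ∷ Γ, "Γ, Γ₁" is Γ ++ Γ₁.

infix 2 _⊢M_
data _⊢M_ : List Fm → List Fm → Set where
  set  : ∀ {Γ Γ' Δ Δ'} → Γ ≈ₛ Γ' → Δ ≈ₛ Δ' → Γ ⊢M Δ → Γ' ⊢M Δ'
  ax   : ∀ {φ} → (φ ∷ []) ⊢M (φ ∷ [])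
  ax⊤  : [] ⊢M (⊤' ∷ [])
  ∧L   : ∀ {Γ Δ φ ψ} → (φ ∷ ψ ∷ Γ) ⊢M Δ → ((φ ∧' ψ) ∷ Γ) ⊢M Δ
  ∧R   : ∀ {Γ Δ φ ψ} → Γ ⊢M (φ ∷ Δ) → Γ ⊢M (ψ ∷ Δ) → Γ ⊢M ((φ ∧' ψ) ∷ Δ)
  ∨L   : ∀ {Γ Δ φ ψ} → (φ ∷ Γ) ⊢M Δ → (ψ ∷ Γ) ⊢M Δ → ((φ ∨' ψ) ∷ Γ) ⊢M Δ
  ∨R   : ∀ {Γ Δ φ ψ} → Γ ⊢M (φ ∷ ψ ∷ Δ) → Γ ⊢M ((φ ∨' ψ) ∷ Δ)
  ⇒L   : ∀ {Γ Δ φ ψ} → (ψ ∷ Γ) ⊢M Δ → Γ ⊢M (φ ∷ Δ) → ((φ ⇒' ψ) ∷ Γ) ⊢M Δ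
  ⇒Rp  : ∀ {Γ Δ φ ψ} → Γ ⊢M (ψ ∷ Δ) → Γ ⊢M ((φ ⇒' ψ) ∷ Δ)
  ∀R   : ∀ {Γ Δ φ} (a : ℕ) → FreshIn a Γ → FreshIn a ((∀' φ) ∷ Δ) →
         Γ ⊢M ((φ [ cfvar a ]) ∷ Δ) → Γ ⊢M ((∀' φ) ∷ Δ)
  ∀L   : ∀ {Γ Δ φ} (u : CTerm) → ((φ [ u ]) ∷ Γ) ⊢M Δ → ((∀' φ) ∷ Γ) ⊢M Δ
  ∃R   : ∀ {Γ Δ φ} (u : CTerm) → Γ ⊢M ((φ [ u ]) ∷ Δ) → Γ ⊢M ((∃' φ) ∷ Δ)
  ∃L   : ∀ {Γ Δ φ} (a : ℕ) → FreshIn a ((∃' φ) ∷ Γ) → FreshIn a Δ →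
         ((φ [ cfvar a ]) ∷ Γ) ⊢M Δ → ((∃' φ) ∷ Γ) ⊢M Δ
  wk   : ∀ {Γ Δ} Γ₁ Δ₁ → Γ ⊢M Δ → (Γ ++ Γ₁) ⊢M (Δ ++ Δ₁)
  cut  : ∀ {Γ Δ Γ₁ Δ₁ φ} → Γ ⊢M (φ ∷ Δ) → (φ ∷ Γ₁) ⊢M Δ₁ →
         (Γ ++ Γ₁) ⊢M (Δ ++ Δ₁)

infix 2 _⊢[_]_
data _⊢[_]_ : List Fm → (List Fm → Fm → Set) → Fm → Set₁ where
  extra : ∀ {Ax Γ θ} → Ax Γ θ → Γ ⊢[ Ax ] θ
  set  : ∀ {Ax Γ Γ' θ} → Γ ≈ₛ Γ' → Γ ⊢[ Ax ] θ → Γ' ⊢[ Ax ] θ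
  ax   : ∀ {Ax φ} → (φ ∷ []) ⊢[ Ax ] φ
  ax⊤  : ∀ {Ax} → [] ⊢[ Ax ] ⊤'
  ∧L   : ∀ {Ax Γ θ φ ψ} → (φ ∷ ψ ∷ Γ) ⊢[ Ax ] θ → ((φ ∧' ψ) ∷ Γ) ⊢[ Ax ] θ
  ∧R   : ∀ {Ax Γ φ ψ} → Γ ⊢[ Ax ] φ → Γ ⊢[ Ax ] ψ → Γ ⊢[ Ax ] φ ∧' ψ
  ∨L   : ∀ {Ax Γ θ φ ψ} → (φ ∷ Γ) ⊢[ Ax ] θ → (ψ ∷ Γ) ⊢[ Ax ] θ →
         ((φ ∨' ψ) ∷ Γ) ⊢[ Ax ] θ
  ∨R₁  : ∀ {Ax Γ φ ψ} → Γ ⊢[ Ax ] φ → Γ ⊢[ Ax ] φ ∨' ψ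
  ∨R₂  : ∀ {Ax Γ φ ψ} → Γ ⊢[ Ax ] ψ → Γ ⊢[ Ax ] φ ∨' ψ
  ⇒L   : ∀ {Ax Γ θ φ ψ} → (ψ ∷ Γ) ⊢[ Ax ] θ → Γ ⊢[ Ax ] φ →
         ((φ ⇒' ψ) ∷ Γ) ⊢[ Ax ] θ
  ⇒Rp  : ∀ {Ax Γ φ ψ} → Γ ⊢[ Ax ] ψ → Γ ⊢[ Ax ] φ ⇒' ψ
  ∀R   : ∀ {Ax Γ φ} (a : ℕ) → FreshIn a ((∀' φ) ∷ Γ) →
         Γ ⊢[ Ax ] φ [ cfvar a ] → Γ ⊢[ Ax ] ∀' φ
  ∀L   : ∀ {Ax Γ θ φ} (u : CTerm) → ((φ [ u ]) ∷ Γ) ⊢[ Ax ] θ →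
         ((∀' φ) ∷ Γ) ⊢[ Ax ] θ
  ∃R   : ∀ {Ax Γ φ} (u : CTerm) → Γ ⊢[ Ax ] φ [ u ] → Γ ⊢[ Ax ] ∃' φ
  ∃L   : ∀ {Ax Γ θ φ} (a : ℕ) → FreshIn a (θ ∷ (∃' φ) ∷ Γ) →
         ((φ [ cfvar a ]) ∷ Γ) ⊢[ Ax ] θ → ((∃' φ) ∷ Γ) ⊢[ Ax ] θ
  wk   : ∀ {Ax Γ θ} Γ₁ → Γ ⊢[ Ax ] θ → (Γ ++ Γ₁) ⊢[ Ax ] θ
  cut  : ∀ {Ax Γ Γ₁ θ φ} → Γ ⊢[ Ax ] φ → (φ ∷ Γ₁) ⊢[ Ax ] θ →
         (Γ ++ Γ₁) ⊢[ Ax ] θ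

data CD : List Fm → Fm → Set where
  cd : ∀ (A : Fm) (B : Formula 1) →
       CD ((∀' (wkF A ∨' B)) ∷ []) (A ∨' ∀' B)

infix 2 _⊢CD_
_⊢CD_ : List Fm → Fm → Set₁
Γ ⊢CD θ = Γ ⊢[ CD ] θ

⋁⁺ : Fm → List Fm → Fm
⋁⁺ φ []       = φ
⋁⁺ φ (ψ ∷ Δ)  = φ ∨' ⋁⁺ ψ Δ

⋁ : List⁺ Fm → Fm
⋁ (φ ∷ Δ) = ⋁⁺ φ Δ

-- Right to left: every rule of QGP+(CD) is a QGPM rule with a one-formula
-- succedent, (CD) is derivable in QGPM because there (∀R) may keep A beside
-- B(a) on the right, and ⋁Δ ⇒ Δ is derivable, so a cut gives Γ ⇒ Δ.
-- Left to right: a QGPM derivation of Γ ⇒ Δ is translated rule by rule into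
-- QGP+(CD) derivations of Γ ⇒ ⋁Δ' for every Δ' ⊇ Δ; each rule acts on one
-- disjunct and the others are carried along by ∨-elimination.  The one rule
-- that does not commute with the side disjuncts is (∀R): from Γ ⇒ ⋁Δ ∨ φ(a)
-- one gets Γ ⇒ ∀x(⋁Δ ∨ φ(x)), and (CD) turns this into Γ ⇒ ⋁Δ ∨ ∀xφ(x).
module Submission where

open import Defs
open import Data.List using (List)
open import Data.List.NonEmpty using (List⁺; toList)
open import Function.Bundles using (_⇔_)

open import Data.Nat using (ℕ)
open import Data.Nat.Properties using (1+n≰n)
open import Data.Fin using (Fin; zero; suc)
open import Data.List using ([]; _∷_; _++_)
open import Data.List.NonEmpty using (_∷_)
open import Data.List.Extrema.Nat using (max; xs≤max)
open import Data.List.Membership.Propositional using (_∈_; _∉_)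
open import Data.List.Membership.Propositional.Properties using (∈-++⁻)
open import Data.List.Properties using (++-identityʳ)
open import Data.List.Relation.Binary.Permutation.Propositional using (↭-swap; ↭-refl)
open import Data.List.Relation.Binary.Subset.Propositional using (_⊆_)
open import Data.List.Relation.Binary.Subset.Propositional.Properties
  using (⊆-refl; ⊆-trans; ⊆-reflexive; ⊆-reflexive-↭; xs⊆x∷xs; ∷⁺ʳ; ∈-∷⁺ʳ; xs⊆xs++ys; xs⊆ys++xs)
open import Data.List.Relation.Unary.All using ([]; _∷_; lookup)
open import Data.List.Relation.Unary.Any using (here; there)
open import Data.Product using (∃-syntax; _,_)
open import Data.Sum using ([_,_]′; reduce)
open import Function using (_∘_; id; mk⇔)
open import Relation.Binary.PropositionalEquality using (_≡_; refl; sym; trans; cong; cong₂; subst)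

substT-lift-wkT : ∀ {n m} (σ : Fin n → Term m) (t : Term n) →
                  substT (lift σ) (wkT t) ≡ wkT (substT σ t)
substT-lift-wkT σ (bvar i)  = refl
substT-lift-wkT σ (fvar a)  = refl
substT-lift-wkT σ (const c) = refl

module _ {n m k} {σ : Fin m → Term k} {τ : Fin n → Term m} {ρ : Fin n → Term k} where

  substT-∘ : (∀ i → substT σ (τ i) ≡ ρ i) → ∀ t → substT σ (substT τ t) ≡ substT ρ t
  substT-∘ h (bvar i)  = h i
  substT-∘ h (fvar a)  = refl
  substT-∘ h (const c) = refl

  substTs-∘ : (∀ i → substT σ (τ i) ≡ ρ i) → ∀ ts → substTs σ (substTs τ ts) ≡ substTs ρ ts
  substTs-∘ h []       = refl
  substTs-∘ h (t ∷ ts) = cong₂ _∷_ (substT-∘ h t) (substTs-∘ h ts)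

  lift-∘ : (∀ i → substT σ (τ i) ≡ ρ i) → ∀ i → substT (lift σ) (lift τ i) ≡ lift ρ i
  lift-∘ h zero    = refl
  lift-∘ h (suc i) = trans (substT-lift-wkT σ (τ i)) (cong wkT (h i))

substF-∘ : ∀ {n m k} {σ : Fin m → Term k} {τ : Fin n → Term m} {ρ : Fin n → Term k} →
           (∀ i → substT σ (τ i) ≡ ρ i) → ∀ φ → substF σ (substF τ φ) ≡ substF ρ φ
substF-∘ h (atom P ts) = cong (atom P) (substTs-∘ h ts)
substF-∘ h ⊤'          = refl
substF-∘ h (φ ∧' ψ)    = cong₂ _∧'_ (substF-∘ h φ) (substF-∘ h ψ)
substF-∘ h (φ ∨' ψ)    = cong₂ _∨'_ (substF-∘ h φ) (substF-∘ h ψ)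
substF-∘ h (φ ⇒' ψ)    = cong₂ _⇒'_ (substF-∘ h φ) (substF-∘ h ψ)
substF-∘ h (∀' φ)      = cong ∀' (substF-∘ (lift-∘ h) φ)
substF-∘ h (∃' φ)      = cong ∃' (substF-∘ (lift-∘ h) φ)

module _ {n} {σ : Fin n → Term n} where

  substT-id : (∀ i → σ i ≡ bvar i) → ∀ t → substT σ t ≡ t
  substT-id h (bvar i)  = h i
  substT-id h (fvar a)  = refl
  substT-id h (const c) = refl

  substTs-id : (∀ i → σ i ≡ bvar i) → ∀ ts → substTs σ ts ≡ ts
  substTs-id h []       = refl
  substTs-id h (t ∷ ts) = cong₂ _∷_ (substT-id h t) (substTs-id h ts)

  lift-id : (∀ i → σ i ≡ bvar i) → ∀ i → lift σ i ≡ bvar i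
  lift-id h zero    = refl
  lift-id h (suc i) = cong wkT (h i)

substF-id : ∀ {n} {σ : Fin n → Term n} → (∀ i → σ i ≡ bvar i) → ∀ φ → substF σ φ ≡ φ
substF-id h (atom P ts) = cong (atom P) (substTs-id h ts)
substF-id h ⊤'          = refl
substF-id h (φ ∧' ψ)    = cong₂ _∧'_ (substF-id h φ) (substF-id h ψ)
substF-id h (φ ∨' ψ)    = cong₂ _∨'_ (substF-id h φ) (substF-id h ψ)
substF-id h (φ ⇒' ψ)    = cong₂ _⇒'_ (substF-id h φ) (substF-id h ψ)
substF-id h (∀' φ)      = cong ∀' (substF-id (lift-id h) φ)
substF-id h (∃' φ)      = cong ∃' (substF-id (lift-id h) φ)

wkF-[] : ∀ (A : Fm) (u : CTerm) → wkF A [ u ] ≡ A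
wkF-[] A u = trans (substF-∘ {ρ = bvar} (λ ()) A) (substF-id (λ _ → refl) A)

fvT-wkT : ∀ {n} (t : Term n) → fvT (wkT t) ≡ fvT t
fvT-wkT (bvar i)  = refl
fvT-wkT (fvar a)  = refl
fvT-wkT (const c) = refl

module _ {n m} {σ : Fin n → Term m} where

  fvT-substT : (∀ i → fvT (σ i) ≡ []) → ∀ t → fvT (substT σ t) ≡ fvT t
  fvT-substT h (bvar i)  = h i
  fvT-substT h (fvar a)  = refl
  fvT-substT h (const c) = refl

  fvTs-substTs : (∀ i → fvT (σ i) ≡ []) → ∀ ts → fvTs (substTs σ ts) ≡ fvTs ts
  fvTs-substTs h []       = refl
  fvTs-substTs h (t ∷ ts) = cong₂ _++_ (fvT-substT h t) (fvTs-substTs h ts)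

  fvT-lift : (∀ i → fvT (σ i) ≡ []) → ∀ i → fvT (lift σ i) ≡ []
  fvT-lift h zero    = refl
  fvT-lift h (suc i) = trans (fvT-wkT (σ i)) (h i)

fv-substF : ∀ {n m} {σ : Fin n → Term m} → (∀ i → fvT (σ i) ≡ []) →
            ∀ φ → fv (substF σ φ) ≡ fv φ
fv-substF h (atom P ts) = fvTs-substTs h ts
fv-substF h ⊤'          = refl
fv-substF h (φ ∧' ψ)    = cong₂ _++_ (fv-substF h φ) (fv-substF h ψ)
fv-substF h (φ ∨' ψ)    = cong₂ _++_ (fv-substF h φ) (fv-substF h ψ)
fv-substF h (φ ⇒' ψ)    = cong₂ _++_ (fv-substF h φ) (fv-substF h ψ)
fv-substF h (∀' φ)      = fv-substF (fvT-lift h) φ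
fv-substF h (∃' φ)      = fv-substF (fvT-lift h) φ

fv-wkF : ∀ (A : Fm) → fv (wkF A) ≡ fv A
fv-wkF = fv-substF (λ ())

∉-++ : ∀ {a : ℕ} {xs ys} → a ∉ xs → a ∉ ys → a ∉ xs ++ ys
∉-++ {xs = xs} a∉xs a∉ys = [ a∉xs , a∉ys ]′ ∘ ∈-++⁻ xs

fresh : ∀ (ns : List ℕ) → ∃[ a ] a ∉ ns
fresh ns = ℕ.suc (max 0 ns) , λ a∈ns → 1+n≰n (lookup (xs≤max 0 ns) a∈ns)

fv-⋁⁺ : ∀ {a} φ Δ → FreshIn a (φ ∷ Δ) → a ∉ fv (⋁⁺ φ Δ)
fv-⋁⁺ φ []      (a∉φ ∷ [])  = a∉φ
fv-⋁⁺ φ (ψ ∷ Δ) (a∉φ ∷ a∉Δ) = ∉-++ a∉φ (fv-⋁⁺ ψ Δ a∉Δ)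

swap-⊆ : ∀ {φ ψ : Fm} {Γ} → φ ∷ ψ ∷ Γ ⊆ ψ ∷ φ ∷ Γ
swap-⊆ = ⊆-reflexive-↭ (↭-swap _ _ ↭-refl)

++-absorbˡ : ∀ {Γ Γ' : List Fm} → Γ ⊆ Γ' → (Γ ++ Γ') ≈ₛ Γ'
++-absorbˡ {Γ} {Γ'} Γ⊆Γ' = [ Γ⊆Γ' , id ]′ ∘ ∈-++⁻ Γ , xs⊆ys++xs Γ' Γ

weaken : ∀ {Ax Γ Γ' θ} → Γ ⊆ Γ' → Γ ⊢[ Ax ] θ → Γ' ⊢[ Ax ] θ
weaken {Γ' = Γ'} Γ⊆Γ' d = set (++-absorbˡ Γ⊆Γ') (wk Γ' d)

assumption : ∀ {Ax Γ φ} → φ ∈ Γ → Γ ⊢[ Ax ] φ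
assumption φ∈Γ = weaken (∈-∷⁺ʳ φ∈Γ (λ ())) ax

cut-shared : ∀ {Ax Γ φ θ} → Γ ⊢[ Ax ] φ → φ ∷ Γ ⊢[ Ax ] θ → Γ ⊢[ Ax ] θ
cut-shared {Γ = Γ} d e = weaken (reduce ∘ ∈-++⁻ Γ) (cut d e)

∨-comm : ∀ {Ax Γ φ ψ} → Γ ⊢[ Ax ] φ ∨' ψ → Γ ⊢[ Ax ] ψ ∨' φ
∨-comm d = cut-shared d (∨L (∨R₂ (assumption (here refl))) (∨R₁ (assumption (here refl))))

⋁⁺-intro : ∀ {Ax Γ φ} d ds → φ ∈ d ∷ ds → φ ∷ Γ ⊢[ Ax ] ⋁⁺ d ds
⋁⁺-intro d []       (here refl) = assumption (here refl)
⋁⁺-intro d (e ∷ es) (here refl) = ∨R₁ (assumption (here refl))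
⋁⁺-intro d (e ∷ es) (there φ∈) = ∨R₂ (⋁⁺-intro e es φ∈)

⋁⁺-elim : ∀ {Ax Γ θ} d ds → (∀ {φ} → φ ∈ d ∷ ds → φ ∷ Γ ⊢[ Ax ] θ) →
          ⋁⁺ d ds ∷ Γ ⊢[ Ax ] θ
⋁⁺-elim d []       h = h (here refl)
⋁⁺-elim d (e ∷ es) h = ∨L (h (here refl)) (⋁⁺-elim e es (h ∘ there))

⋁⁺-cases : ∀ {Ax Γ θ} d ds → Γ ⊢[ Ax ] ⋁⁺ d ds →
           (∀ {φ} → φ ∈ d ∷ ds → φ ∷ Γ ⊢[ Ax ] θ) → Γ ⊢[ Ax ] θ
⋁⁺-cases d ds d∨ds h = cut-shared d∨ds (⋁⁺-elim d ds h)

⋁⁺-elim-head : ∀ {Ax Γ φ Δ} d ds → φ ∷ Γ ⊢[ Ax ] ⋁⁺ d ds → Δ ⊆ d ∷ ds →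
               Γ ⊢[ Ax ] ⋁⁺ φ Δ → Γ ⊢[ Ax ] ⋁⁺ d ds
⋁⁺-elim-head {φ = φ} {Δ} d ds φ⊢ Δ⊆ φ∨Δ =
  ⋁⁺-cases φ Δ φ∨Δ λ { (here refl) → φ⊢ ; (there ψ∈Δ) → ⋁⁺-intro d ds (Δ⊆ ψ∈Δ) }

⋁⁺-mono : ∀ {Ax Γ e es} d ds → e ∷ es ⊆ d ∷ ds → Γ ⊢[ Ax ] ⋁⁺ e es → Γ ⊢[ Ax ] ⋁⁺ d ds
⋁⁺-mono d ds ⊆ds = ⋁⁺-elim-head d ds (⋁⁺-intro d ds (⊆ds (here refl))) (⊆ds ∘ there)

∀R-∨ : ∀ {Γ C φ} a → FreshIn a (C ∷ ∀' φ ∷ Γ) →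
       Γ ⊢CD C ∨' φ [ cfvar a ] → Γ ⊢CD C ∨' ∀' φ
∀R-∨ {Γ} {C} {φ} a (a∉C ∷ a∉φ ∷ a∉Γ) d =
  cut-shared (∀R a (a∉body ∷ a∉Γ) d′) (weaken (xs⊆xs++ys _ Γ) (extra (cd C φ)))
  where
  d′ : Γ ⊢CD (wkF C ∨' φ) [ cfvar a ]
  d′ = subst (λ A → Γ ⊢CD A ∨' φ [ cfvar a ]) (sym (wkF-[] C (cfvar a))) d
  a∉body : a ∉ fv (∀' (wkF C ∨' φ))
  a∉body = subst (λ xs → a ∉ xs ++ fv φ) (sym (fv-wkF C)) (∉-++ a∉C a∉φ)

∀R-⋁⁺ : ∀ {Γ φ} a Δ → FreshIn a Γ → FreshIn a (∀' φ ∷ Δ) →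
        Γ ⊢CD ⋁⁺ (φ [ cfvar a ]) Δ → Γ ⊢CD ⋁⁺ (∀' φ) Δ
∀R-⋁⁺ a []       a∉Γ (a∉φ ∷ [])  d = ∀R a (a∉φ ∷ a∉Γ) d
∀R-⋁⁺ a (e ∷ es) a∉Γ (a∉φ ∷ a∉Δ) d =
  ∨-comm (∀R-∨ a (fv-⋁⁺ e es a∉Δ ∷ a∉φ ∷ a∉Γ) (∨-comm d))

⊢M-succedent-nonempty : ∀ {Γ Δ} → Γ ⊢M Δ → ∃[ φ ] φ ∈ Δ
⊢M-succedent-nonempty (set _ (Δ⊆ , _) d) with ⊢M-succedent-nonempty d
... | φ , φ∈ = φ , Δ⊆ φ∈
⊢M-succedent-nonempty ax            = _ , here refl
⊢M-succedent-nonempty ax⊤           = _ , here refl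
⊢M-succedent-nonempty (∧L d)        = ⊢M-succedent-nonempty d
⊢M-succedent-nonempty (∧R d e)      = _ , here refl
⊢M-succedent-nonempty (∨L d e)      = ⊢M-succedent-nonempty d
⊢M-succedent-nonempty (∨R d)        = _ , here refl
⊢M-succedent-nonempty (⇒L d e)      = ⊢M-succedent-nonempty d
⊢M-succedent-nonempty (⇒Rp d)       = _ , here refl
⊢M-succedent-nonempty (∀R a _ _ d)  = _ , here refl
⊢M-succedent-nonempty (∀L u d)      = ⊢M-succedent-nonempty d
⊢M-succedent-nonempty (∃R u d)      = _ , here refl
⊢M-succedent-nonempty (∃L a _ _ d)  = ⊢M-succedent-nonempty d
⊢M-succedent-nonempty (wk _ Δ₁ d) with ⊢M-succedent-nonempty d
... | φ , φ∈ = φ , xs⊆xs++ys _ Δ₁ φ∈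
⊢M-succedent-nonempty (cut {Δ = Δ} d e) with ⊢M-succedent-nonempty e
... | φ , φ∈ = φ , xs⊆ys++xs _ Δ φ∈

⊢M⇒⊢CD : ∀ {Γ Δ} → Γ ⊢M Δ → ∀ d ds → Δ ⊆ d ∷ ds → Γ ⊢CD ⋁⁺ d ds
⊢M⇒⊢CD (set (Γ⊆ , _) (Δ⊆ , _) p) d ds s = weaken Γ⊆ (⊢M⇒⊢CD p d ds (⊆-trans Δ⊆ s))
⊢M⇒⊢CD ax        d ds s = ⋁⁺-intro d ds (s (here refl))
⊢M⇒⊢CD ax⊤       d ds s = cut ax⊤ (⋁⁺-intro d ds (s (here refl)))
⊢M⇒⊢CD (∧L p)    d ds s = ∧L (⊢M⇒⊢CD p d ds s)
⊢M⇒⊢CD (∧R {Γ} {Δ} {φ} {ψ} p q) d ds s =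
  ⋁⁺-elim-head d ds (⋁⁺-elim-head d ds φ∧ψ⊢ (s ∘ there) (weaken there (⊢M⇒⊢CD q ψ Δ ⊆-refl)))
               (s ∘ there) (⊢M⇒⊢CD p φ Δ ⊆-refl)
  where
  φ∧ψ⊢ : ψ ∷ φ ∷ Γ ⊢CD ⋁⁺ d ds
  φ∧ψ⊢ = cut-shared (∧R (assumption (there (here refl))) (assumption (here refl)))
                    (⋁⁺-intro d ds (s (here refl)))
⊢M⇒⊢CD (∨L p q)  d ds s = ∨L (⊢M⇒⊢CD p d ds s) (⊢M⇒⊢CD q d ds s)
⊢M⇒⊢CD (∨R {Δ = Δ} {φ} {ψ} p) d ds s = ⋁⁺-cases φ (ψ ∷ Δ) (⊢M⇒⊢CD p φ (ψ ∷ Δ) ⊆-refl) λ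
  { (here refl)         → cut (∨R₁ ax) (⋁⁺-intro d ds (s (here refl)))
  ; (there (here refl)) → cut (∨R₂ ax) (⋁⁺-intro d ds (s (here refl)))
  ; (there (there χ∈Δ)) → ⋁⁺-intro d ds (s (there χ∈Δ)) }
⊢M⇒⊢CD (⇒L {Γ} {Δ} {φ} {ψ} p q) d ds s =
  ⋁⁺-elim-head d ds φ⊢ s (weaken there (⊢M⇒⊢CD q φ Δ ⊆-refl))
  where
  φ⊢ : φ ∷ (φ ⇒' ψ) ∷ Γ ⊢CD ⋁⁺ d ds
  φ⊢ = weaken swap-⊆ (⇒L (weaken (∷⁺ʳ ψ there) (⊢M⇒⊢CD p d ds s)) (assumption (here refl)))
⊢M⇒⊢CD (⇒Rp {Δ = Δ} {ψ = ψ} p) d ds s =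
  ⋁⁺-elim-head d ds (cut (⇒Rp ax) (⋁⁺-intro d ds (s (here refl)))) (s ∘ there)
               (⊢M⇒⊢CD p ψ Δ ⊆-refl)
⊢M⇒⊢CD (∀R {Δ = Δ} a a∉Γ a∉Δ p) d ds s =
  ⋁⁺-mono d ds s (∀R-⋁⁺ a Δ a∉Γ a∉Δ (⊢M⇒⊢CD p _ Δ ⊆-refl))
⊢M⇒⊢CD (∀L u p)  d ds s = ∀L u (⊢M⇒⊢CD p d ds s)
⊢M⇒⊢CD (∃R {Δ = Δ} u p) d ds s =
  ⋁⁺-elim-head d ds (cut (∃R u ax) (⋁⁺-intro d ds (s (here refl)))) (s ∘ there)
               (⊢M⇒⊢CD p _ Δ ⊆-refl)
-- The eigenvariable a is fresh for Δ but maybe not for d ∷ ds, so the premise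
-- is translated with target ⋁Δ itself, which needs Δ nonempty.
⊢M⇒⊢CD (∃L {Δ = []} a _ _ p) d ds s with ⊢M-succedent-nonempty p
... | _ , ()
⊢M⇒⊢CD (∃L {Δ = e ∷ es} a a∉ a∉Δ p) d ds s =
  ⋁⁺-mono d ds s (∃L a (fv-⋁⁺ e es a∉Δ ∷ a∉) (⊢M⇒⊢CD p e es ⊆-refl))
⊢M⇒⊢CD (wk Γ₁ Δ₁ p) d ds s = wk Γ₁ (⊢M⇒⊢CD p d ds (⊆-trans (xs⊆xs++ys _ Δ₁) s))
⊢M⇒⊢CD (cut {Γ} {Δ} {Γ₁} {Δ₁} {φ} p q) d ds s =
  ⋁⁺-elim-head d ds
    (weaken (∷⁺ʳ φ (xs⊆ys++xs Γ₁ Γ)) (⊢M⇒⊢CD q d ds (⊆-trans (xs⊆ys++xs Δ₁ Δ) s)))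
    (⊆-trans (xs⊆xs++ys Δ Δ₁) s)
    (weaken (xs⊆xs++ys Γ Γ₁) (⊢M⇒⊢CD p φ Δ ⊆-refl))

weakenM : ∀ {Γ Γ' Δ Δ'} → Γ ⊆ Γ' → Δ ⊆ Δ' → Γ ⊢M Δ → Γ' ⊢M Δ'
weakenM {Γ' = Γ'} {Δ' = Δ'} Γ⊆Γ' Δ⊆Δ' d = set (++-absorbˡ Γ⊆Γ') (++-absorbˡ Δ⊆Δ') (wk Γ' Δ' d)

cd-⊢M : ∀ (A : Fm) (B : Formula 1) → ∀' (wkF A ∨' B) ∷ [] ⊢M (A ∨' ∀' B) ∷ []
cd-⊢M A B with fresh (fv A ++ fv B)
... | a , a∉AB =
  ∨R (weakenM ⊆-refl swap-⊆ (∀R a (a∉prem ∷ []) (a∉B ∷ a∉A ∷ []) (∀L (cfvar a) (∨L A⊢ B⊢))))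
  where
  a∉A : a ∉ fv A
  a∉A = a∉AB ∘ xs⊆xs++ys _ (fv B)
  a∉B : a ∉ fv B
  a∉B = a∉AB ∘ xs⊆ys++xs _ (fv A)
  a∉prem : a ∉ fv (∀' (wkF A ∨' B))
  a∉prem = subst (λ xs → a ∉ xs ++ fv B) (sym (fv-wkF A)) a∉AB
  A⊢ : wkF A [ cfvar a ] ∷ [] ⊢M B [ cfvar a ] ∷ A ∷ []
  A⊢ = subst (λ X → X ∷ [] ⊢M B [ cfvar a ] ∷ A ∷ []) (sym (wkF-[] A (cfvar a)))
             (weakenM ⊆-refl (xs⊆x∷xs _ _) ax)
  B⊢ : B [ cfvar a ] ∷ [] ⊢M B [ cfvar a ] ∷ A ∷ []
  B⊢ = weakenM ⊆-refl (∷⁺ʳ _ (λ ())) ax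

⊢CD⇒⊢M : ∀ {Γ θ} → Γ ⊢CD θ → Γ ⊢M θ ∷ []
⊢CD⇒⊢M (extra (cd A B))     = cd-⊢M A B
⊢CD⇒⊢M (set Γ≈Γ' p)         = set Γ≈Γ' (⊆-refl , ⊆-refl) (⊢CD⇒⊢M p)
⊢CD⇒⊢M ax                   = ax
⊢CD⇒⊢M ax⊤                  = ax⊤
⊢CD⇒⊢M (∧L p)               = ∧L (⊢CD⇒⊢M p)
⊢CD⇒⊢M (∧R p q)             = ∧R (⊢CD⇒⊢M p) (⊢CD⇒⊢M q)
⊢CD⇒⊢M (∨L p q)             = ∨L (⊢CD⇒⊢M p) (⊢CD⇒⊢M q)
⊢CD⇒⊢M (∨R₁ p)              = ∨R (weakenM ⊆-refl (∷⁺ʳ _ (λ ())) (⊢CD⇒⊢M p))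
⊢CD⇒⊢M (∨R₂ p)              = ∨R (weakenM ⊆-refl (xs⊆x∷xs _ _) (⊢CD⇒⊢M p))
⊢CD⇒⊢M (⇒L p q)             = ⇒L (⊢CD⇒⊢M p) (weakenM ⊆-refl (∷⁺ʳ _ (λ ())) (⊢CD⇒⊢M q))
⊢CD⇒⊢M (⇒Rp p)              = ⇒Rp (⊢CD⇒⊢M p)
⊢CD⇒⊢M (∀R a (a∉ ∷ a∉Γ) p)  = ∀R a a∉Γ (a∉ ∷ []) (⊢CD⇒⊢M p)
⊢CD⇒⊢M (∀L u p)             = ∀L u (⊢CD⇒⊢M p)
⊢CD⇒⊢M (∃R u p)             = ∃R u (⊢CD⇒⊢M p)
⊢CD⇒⊢M (∃L a (a∉θ ∷ a∉) p)  = ∃L a a∉ (a∉θ ∷ []) (⊢CD⇒⊢M p)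
⊢CD⇒⊢M (wk Γ₁ p)            = wk Γ₁ [] (⊢CD⇒⊢M p)
⊢CD⇒⊢M (cut p q)            = cut (⊢CD⇒⊢M p) (⊢CD⇒⊢M q)

⋁⁺-⊢M : ∀ d ds → ⋁⁺ d ds ∷ [] ⊢M d ∷ ds
⋁⁺-⊢M d []       = ax
⋁⁺-⊢M d (e ∷ es) = ∨L (weakenM ⊆-refl (∷⁺ʳ d (λ ())) ax) (weakenM ⊆-refl (xs⊆x∷xs _ d) (⋁⁺-⊢M e es))

theorem3 : (Γ : List Fm) (Δ : List⁺ Fm) →
           (Γ ⊢M toList Δ) ⇔ (Γ ⊢CD ⋁ Δ)
theorem3 Γ (d ∷ ds) = mk⇔
  (λ p → ⊢M⇒⊢CD p d ds ⊆-refl)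
  (λ p → weakenM (⊆-reflexive (++-identityʳ Γ)) ⊆-refl (cut (⊢CD⇒⊢M p) (⋁⁺-⊢M d ds)))
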